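{- Every nonempty word $w$ over $\{0,1\}$ can be written as a concatenation $w = W_{\epsilon_1}^{\ell_1} \cdots W_{\epsilon_n}^{\ell_n}$ of alternating blocks such that, for each $i < n$, the last letter of $W_{\epsilon_i}^{\ell_i}$ equals the first letter of $W_{\epsilon_{i+1}}^{\ell_{i+1}}$. This representation is unique, and its number of blocks $n$ is the minimal number of blocks in any decomposition of $w$ as a concatenation of alternating blocks.
   Context: For $\epsilon \in \{0,1\}$ and an integer $\ell \geq 1$, the alternating block $W_\epsilon^\ell$ is the word consisting of the first $\ell$ letters of the infinite alternating string $\epsilon(1-\epsilon)\epsilon(1-\epsilon)\cdots$ (e.g. $W_0^3 = 010$, $W_1^1 = 1$). -}

module Defs where

open import Data.Bool using (Bool; not)
open import Data.Nat using (ℕ; zero; suc; _≤_)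
open import Data.List using (List; []; _∷_; _++_; concat; map; last; head)
open import Data.List.Relation.Unary.All using (All)
open import Data.List.Relation.Unary.Linked using (Linked)
open import Data.Product using (_×_; _,_; proj₁; proj₂)
open import Data.Maybe using (Maybe; just)
open import Relation.Binary.PropositionalEquality using (_≡_)

-- Letters 0,1 are encoded as Bool (false = 0, true = 1); 1 - ε is `not ε`.
Word : Set
Word = List Bool

W : Bool → ℕ → Word
W ε zero    = []
W ε (suc ℓ) = ε ∷ W (not ε) ℓ

Block : Set
Block = Bool × ℕ

block : Block → Word
block (ε , ℓ) = W ε ℓ

IsDecomposition : List Block → Word → Set
IsDecomposition bs w = All (λ b → 1 ≤ proj₂ b) bs × concat (map block bs) ≡ w

Glued : Block → Block → Set
Glued b c = last (block b) ≡ head (block c)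

IsGluedDecomposition : List Block → Word → Set
IsGluedDecomposition bs w = IsDecomposition bs w × Linked Glued bs

module Submission where

-- Call a position of a word a *repeat* when the letter there equals the
-- next one.  Inside an alternating block consecutive letters differ, so in
-- any decomposition of w every repeat lies on a boundary between two
-- consecutive blocks; hence a decomposition into n blocks has
-- n ≥ 1 + (number of repeats of w)  (`fewest-blocks`).
--
-- Conversely, cutting a nonempty word exactly at its repeats gives the
-- canonical decomposition: it is glued (each cut separates two equal
-- letters) and has exactly 1 + (number of repeats) blocks, so it is minimal.  For
-- uniqueness, in a glued decomposition every boundary separates two equal
-- letters, i.e. is a repeat, and no repeat is interior to a block; so the
-- scan recovers any glued decomposition (`scan-recovers`).

open import Defs
open import Data.Nat using (_≤_)
open import Data.List using (List; []; length)
open import Data.Product using (Σ; _×_)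
open import Relation.Binary.PropositionalEquality using (_≡_; _≢_)

open import Data.Bool using (Bool; true; false; not)
open import Data.Nat using (ℕ; zero; suc; z≤n; s≤s)
open import Data.Nat.Properties using (≤-refl; ≤-reflexive; n≤1+n; module ≤-Reasoning)
open import Data.List using (_∷_; _++_; concat; map)
open import Data.List.Relation.Unary.All using (All; []; _∷_)
open import Data.List.Relation.Unary.Linked using (Linked; [-]; _∷_)
open import Data.Product using (_,_; proj₁; proj₂)
open import Relation.Binary.PropositionalEquality using (refl; cong; sym; module ≡-Reasoning)
open import Data.Empty using (⊥-elim)

spell : List Block → Word
spell bs = concat (map block bs)

Positive : List Block → Set
Positive = All (λ b → 1 ≤ proj₂ b)

data Adjacent (x : Bool) : Bool → Set where
  repeated  : Adjacent x x
  alternate : Adjacent x (not x)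

adjacent : ∀ x y → Adjacent x y
adjacent false false = repeated
adjacent false true  = alternate
adjacent true  true  = repeated
adjacent true  false = alternate

countRepeat : ∀ {x y} → Adjacent x y → ℕ → ℕ
countRepeat repeated  n = suc n
countRepeat alternate n = n

repeats : Word → ℕ
repeats []          = 0
repeats (x ∷ [])    = 0
repeats (x ∷ y ∷ t) = countRepeat (adjacent x y) (repeats (y ∷ t))

repeats-alternate : ∀ x t → repeats (x ∷ not x ∷ t) ≡ repeats (not x ∷ t)
repeats-alternate false t = refl
repeats-alternate true  t = refl

repeats-cons : ∀ x w → repeats (x ∷ w) ≤ suc (repeats w)
repeats-cons x [] = z≤n
repeats-cons x (y ∷ t) with adjacent x y
... | repeated  = ≤-refl
... | alternate = n≤1+n _

-- The last letter of the block W ε (1 + ℓ).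
final : Bool → ℕ → Bool
final ε zero    = ε
final ε (suc ℓ) = final (not ε) ℓ

repeats-block : ∀ ε ℓ w → repeats (W ε (suc ℓ) ++ w) ≡ repeats (final ε ℓ ∷ w)
repeats-block ε zero    w = refl
repeats-block ε (suc ℓ) w = begin
  repeats (ε ∷ not ε ∷ u)          ≡⟨ repeats-alternate ε u ⟩
  repeats (W (not ε) (suc ℓ) ++ w) ≡⟨ repeats-block (not ε) ℓ w ⟩
  repeats (final (not ε) ℓ ∷ w)    ∎
  where
  open ≡-Reasoning
  u : Word
  u = W (not (not ε)) ℓ ++ w

repeats-bound : ∀ {b cs} → Positive (b ∷ cs) → repeats (spell (b ∷ cs)) ≤ length cs
repeats-bound {ε , zero}  (() ∷ _)
repeats-bound {ε , suc ℓ} {[]} _ = ≤-reflexive (repeats-block ε ℓ [])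
repeats-bound {ε , suc ℓ} {c ∷ cs} (_ ∷ ps) = begin
  repeats (W ε (suc ℓ) ++ rest) ≡⟨ repeats-block ε ℓ rest ⟩
  repeats (final ε ℓ ∷ rest)    ≤⟨ repeats-cons (final ε ℓ) rest ⟩
  suc (repeats rest)            ≤⟨ s≤s (repeats-bound ps) ⟩
  suc (length cs)               ∎
  where
  open ≤-Reasoning
  rest : Word
  rest = spell (c ∷ cs)

fewest-blocks : ∀ {w cs} → IsDecomposition cs w → w ≢ [] →
                suc (repeats w) ≤ length cs
fewest-blocks {cs = []}    (_  , refl) w≢[] = ⊥-elim (w≢[] refl)
fewest-blocks {cs = _ ∷ _} (ps , refl) _    = s≤s (repeats-bound ps)

withHead : Bool → ℕ × List Block → List Block
withHead x (ℓ , bs) = (x , suc ℓ) ∷ bs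

-- scan x t = (ℓ , bs) describes the canonical decomposition of x ∷ t as
-- (x , 1 + ℓ) ∷ bs.
prepend : ∀ {x y} → Adjacent x y → ℕ × List Block → ℕ × List Block
prepend {y = y} repeated  s = (0 , withHead y s)
prepend         alternate s = (suc (proj₁ s) , proj₂ s)

scan : Bool → Word → ℕ × List Block
scan x []      = (0 , [])
scan x (y ∷ t) = prepend (adjacent x y) (scan y t)

canonical : Bool → Word → List Block
canonical x t = withHead x (scan x t)

-- `scan` at a repeat and at an alternation, for a symbolic letter x (where
-- `adjacent x x` and `adjacent x (not x)` do not compute).
scan-repeat : ∀ x t → scan x (x ∷ t) ≡ (0 , canonical x t)
scan-repeat false t = refl
scan-repeat true  t = refl

scan-alternate : ∀ x t →
  scan x (not x ∷ t) ≡ (suc (proj₁ (scan (not x) t)) , proj₂ (scan (not x) t))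
scan-alternate false t = refl
scan-alternate true  t = refl

canonical-spells : ∀ x t → spell (canonical x t) ≡ x ∷ t
canonical-spells x [] = refl
canonical-spells x (y ∷ t) with adjacent x y
... | repeated  = cong (x ∷_) (canonical-spells x t)
... | alternate = cong (x ∷_) (canonical-spells (not x) t)

scan-positive : ∀ x t → Positive (proj₂ (scan x t))
scan-positive x [] = []
scan-positive x (y ∷ t) with adjacent x y
... | repeated  = s≤s z≤n ∷ scan-positive x t
... | alternate = scan-positive (not x) t

relink-head : ∀ {A : Set} {R : A → A → Set} {a b xs} →
              (∀ {c} → R a c → R b c) → Linked R (a ∷ xs) → Linked R (b ∷ xs)
relink-head {xs = []}    _ _       = [-]
relink-head {xs = _ ∷ _} f (r ∷ l) = f r ∷ l

-- Blocks (x , 2 + ℓ) and (not x , 1 + ℓ) end in the same letter, so they are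
-- glued to the same blocks; in either direction `relink-head` applies with
-- the identity.
glued-extend : ∀ {x ℓ bs} → Linked Glued ((not x , suc ℓ) ∷ bs) →
               Linked Glued ((x , suc (suc ℓ)) ∷ bs)
glued-extend = relink-head (λ g → g)

glued-shrink : ∀ {x ℓ bs} → Linked Glued ((x , suc (suc ℓ)) ∷ bs) →
               Linked Glued ((not x , suc ℓ) ∷ bs)
glued-shrink = relink-head (λ g → g)

canonical-glued : ∀ x t → Linked Glued (canonical x t)
canonical-glued x [] = [-]
canonical-glued x (y ∷ t) with adjacent x y
... | repeated  = refl ∷ canonical-glued x t
... | alternate = glued-extend (canonical-glued (not x) t)

scan-length : ∀ x t → length (proj₂ (scan x t)) ≡ repeats (x ∷ t)
scan-length x [] = refl
scan-length x (y ∷ t) with adjacent x y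
... | repeated  = cong suc (scan-length x t)
... | alternate = scan-length (not x) t

scan-recovers : ∀ ε ℓ cs → Positive cs → Linked Glued ((ε , suc ℓ) ∷ cs) →
                scan ε (W (not ε) ℓ ++ spell cs) ≡ (ℓ , cs)
scan-recovers ε zero [] _ _ = refl
scan-recovers ε zero ((δ , zero) ∷ cs) (() ∷ _) _
scan-recovers ε zero ((.ε , suc m) ∷ cs) (_ ∷ ps) (refl ∷ l) = begin
  scan ε (ε ∷ u)              ≡⟨ scan-repeat ε u ⟩
  (0 , withHead ε (scan ε u)) ≡⟨ cong (λ s → 0 , withHead ε s) recovered ⟩
  (0 , (ε , suc m) ∷ cs)      ∎
  where
  open ≡-Reasoning
  u : Word
  u = W (not ε) m ++ spell cs
  recovered : scan ε u ≡ (m , cs)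
  recovered = scan-recovers ε m cs ps l
scan-recovers ε (suc ℓ) cs ps l = begin
  scan ε (not ε ∷ u)           ≡⟨ scan-alternate ε u ⟩
  (suc (proj₁ s) , proj₂ s)    ≡⟨ cong (λ p → suc (proj₁ p) , proj₂ p) recovered ⟩
  (suc ℓ , cs)                 ∎
  where
  open ≡-Reasoning
  u : Word
  u = W (not (not ε)) ℓ ++ spell cs
  s : ℕ × List Block
  s = scan (not ε) u
  recovered : s ≡ (ℓ , cs)
  recovered = scan-recovers (not ε) ℓ cs ps (glued-shrink l)

glued-unique : ∀ {x t cs} → IsGluedDecomposition cs (x ∷ t) → cs ≡ canonical x t
glued-unique {cs = []} ((_ , ()) , _)
glued-unique {cs = (ε , zero) ∷ cs} (((() ∷ _) , _) , _)
glued-unique {cs = (ε , suc ℓ) ∷ cs} (((_ ∷ ps) , refl) , l) =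
  sym (cong (withHead ε) (scan-recovers ε ℓ cs ps l))

lemma3p2 : (w : Word) → w ≢ [] →
    Σ (List Block) (λ bs →
    IsGluedDecomposition bs w
    × ((cs : List Block) → IsGluedDecomposition cs w → cs ≡ bs)
    × ((cs : List Block) → IsDecomposition cs w → length bs ≤ length cs))
lemma3p2 []      w≢[] = ⊥-elim (w≢[] refl)
lemma3p2 (x ∷ t) w≢[] =
  canonical x t
  , ((s≤s z≤n ∷ scan-positive x t , canonical-spells x t) , canonical-glued x t)
  , (λ _ → glued-unique)
  , λ cs dec → begin
      suc (length (proj₂ (scan x t))) ≡⟨ cong suc (scan-length x t) ⟩
      suc (repeats (x ∷ t))           ≤⟨ fewest-blocks dec w≢[] ⟩
      length cs                       ∎
  where open ≤-Reasoning
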